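{- Let $G$ be a graph and $k,q\geq 1$. Cops has a winning strategy in the monotone game $\mathrm{MonCR}^k_q(G)$ if and only if $G\in\mathcal{T}^k_q$.
   Context: Graphs are finite, simple, undirected. For $X\subseteq V$ and a vertex $v\notin X$ of $G$, $\gamma^X_v$ denotes the connected component of $G\setminus X$ containing $v$. The monotone $q$-round $k$-cops-and-robber game $\mathrm{MonCR}^k_q(G)$ is played on $G'$, obtained from $G$ by adding a disjoint $k$-clique $K$. Cop positions are $k$-element subsets $X\subseteq V(G')$; the robber occupies a vertex of $G$. Initially all cops are on $K$ and Robber chooses any vertex of $G$. In round $i\leq q$, with cops on $X_i$ and robber on $v_i$: Cops chooses $X_{i+1}$ with $|X_i\cap X_{i+1}|=k-1$ and $\gamma^{X_i}_{v_i}\supseteq\gamma^{X_i\cap X_{i+1}}_{v_i}$ (monotonicity); Robber then moves along a path from $v_i$ to some $v_{i+1}$ with no inner vertex in $X_i\cap X_{i+1}$; Cops wins if $v_{i+1}\in X_{i+1}$. Robber wins if Cops has not won after $q$ rounds. A rooted forest is viewed as its ancestor order $\preceq$, height = size of longest chain. A $k$-pebble forest cover of $G$ is a rooted forest on $V(G)$ with $p\colon V(G)\to[k]$ such that every edge $uv$ has $u\preceq v$ or $v\preceq u$, and if $uv\in E(G)$, $u\prec v$, then every $w$ with $u\prec w\preceq v$ has $p(w)\neq p(u)$; depth = height. $\mathcal{T}^k_q$ is the class of graphs with a $k$-pebble forest cover of depth at most $q$. -}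

module Defs where

open import Level using (0ℓ)
open import Data.Nat using (ℕ; zero; suc; _+_; _∸_; _≤_)
open import Data.Fin using (Fin)
open import Data.Fin.Subset using (Subset; _∈_; _∉_; _∩_; ∣_∣)
import Data.Fin.Subset as S
open import Data.List using (List; length)
open import Data.List.Relation.Unary.Unique.Propositional using (Unique)
open import Data.List.Relation.Unary.AllPairs using (AllPairs)
open import Data.Product using (Σ; _×_; _,_; ∃)
open import Data.Sum using (_⊎_)
open import Data.Empty using (⊥)
open import Relation.Nullary using (¬_; Dec)
open import Relation.Binary.PropositionalEquality using (_≡_; _≢_)

record Graph (n : ℕ) : Set₁ where
  field
    E       : Fin n → Fin n → Set
    E-dec   : ∀ u v → Dec (E u v)
    E-sym   : ∀ {u v} → E u v → E v u
    E-irr   : ∀ {u} → ¬ E u u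

module _ {n : ℕ} (G : Graph n) where
  open Graph G

  -- Walk A u w : a walk from u to w in G all of whose INNER vertices
  -- avoid A (endpoints unrestricted; the trivial walk u = w is allowed).
  data Walk (A : Subset n) : Fin n → Fin n → Set where
    stay : ∀ {u} → Walk A u u
    edge : ∀ {u w} → E u w → Walk A u w
    via  : ∀ {u x w} → E u x → x ∉ A → Walk A x w → Walk A u w

  -- w lies in the component γ^A_v of G ∖ A containing v (v ∉ A).
  InComp : Subset n → Fin n → Fin n → Set
  InComp A v w = v ∉ A × w ∉ A × Walk A v w

-- Cop positions: subsets X of V(G') = V(G) ⊎ K, K a disjoint k-clique,
-- represented as a pair (part in V(G), part in K).  Since K is a
-- disjoint clique (no edges to G), walks/components starting in G never
-- leave G, so only the G-part of X matters for the robber.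

record CopPos (n k : ℕ) : Set where
  constructor cops
  field
    inG  : Subset n
    inK  : Subset k

open CopPos public

size : ∀ {n k} → CopPos n k → ℕ
size X = ∣ inG X ∣ + ∣ inK X ∣

_∩ᶜ_ : ∀ {n k} → CopPos n k → CopPos n k → CopPos n k
X ∩ᶜ Y = cops (inG X ∩ inG Y) (inK X ∩ inK Y)

onK : ∀ {n k} → CopPos n k
onK = cops S.⊥ S.⊤

module _ {n : ℕ} (G : Graph n) (k : ℕ) where

  LegalMove : CopPos n k → Fin n → CopPos n k → Set
  LegalMove X v X' =
    size X' ≡ k ×
    size (X ∩ᶜ X') ≡ k ∸ 1 ×
    (∀ w → InComp G (inG (X ∩ᶜ X')) v w → InComp G (inG X) v w)

  -- This nested ∃/∀ game-tree formula is exactly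
  -- the existence of a (history dependent) winning strategy.
  CopsWin : ℕ → CopPos n k → Fin n → Set
  CopsWin zero    X v = ⊥
  CopsWin (suc r) X v =
    Σ (CopPos n k) λ X' → LegalMove X v X' ×
      (∀ v' → Walk G (inG (X ∩ᶜ X')) v v' → v' ∈ inG X' ⊎ CopsWin r X' v')

  CopsWinsMonCR : ℕ → Set
  CopsWinsMonCR q = ∀ v → CopsWin q onK v

-- Rooted forests on Fin n, given as their ancestor order ≼
-- (a partial order whose down-sets {u : u ≼ v} are chains).

record RootedForest (n : ℕ) : Set₁ where
  field
    _≼_      : Fin n → Fin n → Set
    ≼-dec    : ∀ u v → Dec (u ≼ v)
    ≼-refl   : ∀ {u} → u ≼ u
    ≼-trans  : ∀ {u v w} → u ≼ v → v ≼ w → u ≼ w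
    ≼-antisym : ∀ {u v} → u ≼ v → v ≼ u → u ≡ v
    ≼-forest : ∀ {u w v} → u ≼ v → w ≼ v → u ≼ w ⊎ w ≼ u

  _≺_ : Fin n → Fin n → Set
  u ≺ v = u ≼ v × u ≢ v

  Comparable : Fin n → Fin n → Set
  Comparable u v = u ≼ v ⊎ v ≼ u

  IsChain : List (Fin n) → Set
  IsChain xs = Unique xs × AllPairs Comparable xs

  HeightAtMost : ℕ → Set
  HeightAtMost h = ∀ xs → IsChain xs → length xs ≤ h

record PebbleForestCover {n : ℕ} (G : Graph n) (k q : ℕ) : Set₁ where
  field
    F : RootedForest n
  open RootedForest F
  open Graph G
  field
    p        : Fin n → Fin k
    edges    : ∀ {u v} → E u v → Comparable u v
    pebbles  : ∀ {u v w} → E u v → u ≺ v → u ≺ w → w ≼ v → p w ≢ p u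
    depth    : HeightAtMost q

InT : ∀ {n} → Graph n → ℕ → ℕ → Set₁
InT G k q = PebbleForestCover G k q

-- Forest cover ⇒ winning strategy: the cops descend a root-to-leaf path of the forest.  With the
-- current node w, every proper ancestor of w adjacent to the subtree of w is held by the cop carrying
-- its pebble, and the cops now put the cop carrying p w on w.  The pebble condition says that this
-- cop guards no such ancestor, so the robber is trapped in the subtree of w, hence below a child c
-- of w at which the cops continue; the height of the forest bounds the number of rounds.
--
-- Winning strategy ⇒ forest cover: for every vertex t let the strategy play against a robber who
-- heads for t, always moving to a canonical vertex of the component of t.  The history of t lists
-- the cops placed inside the robber's component, each labelled by a pebble not used by a recorded
-- vertex that is still occupied.  Targets in a common component give identical plays until one of
-- them is caught, so histories are closed under prefixes and "u occurs in the history of v" is a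
-- forest order.  A round places at most one new cop (so histories have length at most q), and by
-- monotonicity a recorded cop adjacent to the target is never lifted (so the labels satisfy the
-- pebble condition).

module Submission where

open import Defs
open import Level using (0ℓ)
open import Function using (_∘_; const)
open import Data.Nat using (ℕ; zero; suc; _+_; _∸_; _≤_; _<_; z≤n; s≤s)
open import Data.Nat.Properties
open import Data.Fin using (Fin; zero; suc)
open import Data.Fin.Properties using (any?) renaming (_≟_ to _≟ᶠ_)
open import Data.Fin.Subset using (Subset; _∈_; _∉_; _∩_; _∪_; _-_; ∣_∣; ⁅_⁆; inside; outside; _⊆_; Nonempty)
import Data.Fin.Subset as S
open import Data.Fin.Subset.Properties
open import Data.Vec using ([]; _∷_; here; there; tabulate)
open import Data.Vec.Properties using (lookup∘tabulate; lookup⇒[]=; []=⇒lookup)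
open import Data.Vec.Functional using (updateAt)
open import Data.Vec.Functional.Properties using (updateAt-updates; updateAt-minimal)
open import Data.List using (List; []; _∷_; length; _++_; _∷ʳ_; map; last; initLast; _∷ʳ′_)
open import Data.List.Properties
  using (∷-injective; ++-assoc; ++-identityʳ; ++-identityʳ-unique; ++-conicalˡ; map-++; ∷ʳ-injective; length-++; length-map)
open import Data.List.Membership.Propositional using () renaming (_∈_ to _∈ₗ_; _∉_ to _∉ₗ_)
open import Data.List.Membership.Propositional.Properties using (∈-++⁺ˡ; ∈-++⁺ʳ; ∈-++⁻; ∈-map⁺)
open import Data.List.Relation.Unary.Any using (here; there)
import Data.List.Relation.Unary.Any as Any
open import Data.List.Relation.Unary.All as All using (All; []; _∷_)
open import Data.List.Relation.Unary.AllPairs using (AllPairs; []; _∷_)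
open import Data.List.Relation.Unary.Unique.Propositional using (Unique)
import Data.List.Relation.Unary.Unique.Propositional.Properties as Unique
open import Data.Maybe using (Maybe; just; nothing; maybe′)
open import Data.Product using (_×_; _,_; ∃; ∃₂; proj₁; proj₂)
open import Data.Sum using (_⊎_; inj₁; inj₂)
import Data.Sum as Sum
open import Data.Sum.Properties using (inj₁-injective; inj₂-injective)
open import Data.Empty using (⊥; ⊥-elim)
open import Data.Bool using (true)
open import Relation.Nullary using (¬_; Dec; yes; no; does; ¬?; _×-dec_; contradiction)
open import Relation.Nullary.Decidable using (decidable-stable; dec-true; map′)
open import Relation.Unary using (Pred; Decidable)
open import Relation.Binary.PropositionalEquality

∣⁅x⁆∪p∣≡1+∣p∣ : ∀ {n} (x : Fin n) (p : Subset n) → x ∉ p → ∣ ⁅ x ⁆ ∪ p ∣ ≡ suc ∣ p ∣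
∣⁅x⁆∪p∣≡1+∣p∣ zero    (inside  ∷ p) x∉p = contradiction here x∉p
∣⁅x⁆∪p∣≡1+∣p∣ zero    (outside ∷ p) x∉p = cong (suc ∘ ∣_∣) (∪-identityˡ p)
∣⁅x⁆∪p∣≡1+∣p∣ (suc x) (inside  ∷ p) x∉p = cong suc (∣⁅x⁆∪p∣≡1+∣p∣ x p (x∉p ∘ there))
∣⁅x⁆∪p∣≡1+∣p∣ (suc x) (outside ∷ p) x∉p = ∣⁅x⁆∪p∣≡1+∣p∣ x p (x∉p ∘ there)

∣⁅x⁆∪p∣≤1+∣p∣ : ∀ {n} (x : Fin n) (p : Subset n) → ∣ ⁅ x ⁆ ∪ p ∣ ≤ suc ∣ p ∣
∣⁅x⁆∪p∣≤1+∣p∣ zero    (inside  ∷ p) = s≤s (≤-trans (≤-reflexive (cong ∣_∣ (∪-identityˡ p))) (n≤1+n _))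
∣⁅x⁆∪p∣≤1+∣p∣ zero    (outside ∷ p) = s≤s (≤-reflexive (cong ∣_∣ (∪-identityˡ p)))
∣⁅x⁆∪p∣≤1+∣p∣ (suc x) (inside  ∷ p) = s≤s (∣⁅x⁆∪p∣≤1+∣p∣ x p)
∣⁅x⁆∪p∣≤1+∣p∣ (suc x) (outside ∷ p) = ∣⁅x⁆∪p∣≤1+∣p∣ x p

1+∣p-x∣≡∣p∣ : ∀ {n} {x : Fin n} (p : Subset n) → x ∈ p → suc ∣ p - x ∣ ≡ ∣ p ∣
1+∣p-x∣≡∣p∣ {x = zero}  (inside  ∷ p) x∈p       = cong (suc ∘ ∣_∣) (p─⊥≡p p)
1+∣p-x∣≡∣p∣ {x = suc x} (inside  ∷ p) (there x∈p) = cong suc (1+∣p-x∣≡∣p∣ p x∈p)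
1+∣p-x∣≡∣p∣ {x = suc x} (outside ∷ p) (there x∈p) = 1+∣p-x∣≡∣p∣ p x∈p

x∈p─q⇒x∉q : ∀ {n} {x : Fin n} (p q : Subset n) → x ∈ p S.─ q → x ∉ q
x∈p─q⇒x∉q (inside  ∷ p) (outside ∷ q) here       ()
x∈p─q⇒x∉q (_       ∷ p) (_       ∷ q) (there x∈) (there x∈q) = x∈p─q⇒x∉q p q x∈ x∈q

x∈p-y⇒x≢y : ∀ {n} {x y : Fin n} (p : Subset n) → x ∈ p - y → x ≢ y
x∈p-y⇒x≢y p x∈ refl = x∈p─q⇒x∉q p _ x∈ (x∈⁅x⁆ _)

length≤∣p∣ : ∀ {n} {xs : List (Fin n)} (p : Subset n) → Unique xs → (∀ {x} → x ∈ₗ xs → x ∈ p) →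
             length xs ≤ ∣ p ∣
length≤∣p∣ {xs = []}     p _          _   = z≤n
length≤∣p∣ {xs = x ∷ xs} p (x∉ ∷ uxs) xs⊆ = begin
  suc (length xs)  ≤⟨ s≤s (length≤∣p∣ (p - x) uxs xs⊆p-x) ⟩
  suc ∣ p - x ∣    ≡⟨ 1+∣p-x∣≡∣p∣ p (xs⊆ (here refl)) ⟩
  ∣ p ∣            ∎
  where
  open ≤-Reasoning
  xs⊆p-x : ∀ {y} → y ∈ₗ xs → y ∈ p - x
  xs⊆p-x y∈ = x∈p∧x≢y⇒x∈p-y (xs⊆ (there y∈)) (λ y≡x → All.lookup x∉ y∈ (sym y≡x))

fromList : ∀ {n} → List (Fin n) → Subset n
fromList []       = S.⊥
fromList (x ∷ xs) = ⁅ x ⁆ ∪ fromList xs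

∈-fromList : ∀ {n} {x : Fin n} {xs} → x ∈ₗ xs → x ∈ fromList xs
∈-fromList {x = x} (here refl) = x∈p∪q⁺ (inj₁ (x∈⁅x⁆ x))
∈-fromList         (there x∈)  = x∈p∪q⁺ (inj₂ (∈-fromList x∈))

∣fromList∣≤length : ∀ {n} (xs : List (Fin n)) → ∣ fromList xs ∣ ≤ length xs
∣fromList∣≤length {n} []       = ≤-reflexive (∣⊥∣≡0 n)
∣fromList∣≤length     (x ∷ xs) = ≤-trans (∣⁅x⁆∪p∣≤1+∣p∣ x (fromList xs)) (s≤s (∣fromList∣≤length xs))

_∈ₗ?_ : ∀ {n} (x : Fin n) (xs : List (Fin n)) → Dec (x ∈ₗ xs)
x ∈ₗ? xs = Any.any? (x ≟ᶠ_) xs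

unlisted : ∀ {m} → List (Fin (suc m)) → Fin (suc m)
unlisted xs with any? (λ i → ¬? (i ∈ₗ? xs))
... | yes (i , _) = i
... | no  _       = zero

unlisted-∉ : ∀ {m} (xs : List (Fin (suc m))) → length xs < suc m → unlisted xs ∉ₗ xs
unlisted-∉ {m} xs len<m with any? (λ i → ¬? (i ∈ₗ? xs))
... | yes (_ , i∉xs) = i∉xs
... | no  none       = ⊥-elim (<⇒≱ len<m (begin
  suc m                 ≡⟨ ∣⊤∣≡n (suc m) ⟨
  ∣ S.⊤ {suc m} ∣       ≤⟨ p⊆q⇒∣p∣≤∣q∣ {p = S.⊤} (λ {i} _ → ∈-fromList (listed i)) ⟩
  ∣ fromList xs ∣       ≤⟨ ∣fromList∣≤length xs ⟩
  length xs             ∎))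
  where
  open ≤-Reasoning
  listed : ∀ i → i ∈ₗ xs
  listed i = decidable-stable (i ∈ₗ? xs) (λ i∉ → none (i , i∉))

module _ {n : ℕ} {P : Pred (Fin n) 0ℓ} (P? : Decidable P) where

  fromDec : Subset n
  fromDec = tabulate (does ∘ P?)

  ∈-fromDec⁺ : ∀ {x} → P x → x ∈ fromDec
  ∈-fromDec⁺ {x} px = lookup⇒[]= x fromDec (trans (lookup∘tabulate _ x) (dec-true (P? x) px))

  ∈-fromDec⁻ : ∀ {x} → x ∈ fromDec → P x
  ∈-fromDec⁻ {x} x∈ = decided (P? x) (trans (sym (lookup∘tabulate _ x)) ([]=⇒lookup x∈))
    where
    decided : (d : Dec (P x)) → does d ≡ true → P x
    decided (yes px) _ = px

first : ∀ {n} (p : Subset n) → Nonempty p → Fin n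
first p ne with nonempty? p
... | yes (x , _) = x
... | no  empty   = contradiction ne empty

first-∈ : ∀ {n} (p : Subset n) (ne : Nonempty p) → first p ne ∈ p
first-∈ p ne with nonempty? p
... | yes (_ , x∈p) = x∈p
... | no  empty     = contradiction ne empty

first-cong : ∀ {n} {p q : Subset n} (ne : Nonempty p) (ne′ : Nonempty q) → p ≡ q → first p ne ≡ first q ne′
first-cong {p = p} ne ne′ refl with nonempty? p
... | yes _     = refl
... | no  empty = contradiction ne empty

-- Connected components

module Components {n : ℕ} (G : Graph n) where
  open Graph G

  walk-⊇ : ∀ {A B u w} → B ⊆ A → Walk G A u w → Walk G B u w
  walk-⊇ B⊆A stay           = stay
  walk-⊇ B⊆A (edge e)       = edge e
  walk-⊇ B⊆A (via e x∉A r)  = via e (x∉A ∘ B⊆A) (walk-⊇ B⊆A r)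

  walk-snoc : ∀ {A u x z} → Walk G A u x → x ∉ A → E x z → Walk G A u z
  walk-snoc stay          x∉A e = edge e
  walk-snoc (edge e′)     x∉A e = via e′ x∉A (edge e)
  walk-snoc (via e′ y∉A r) x∉A e = via e′ y∉A (walk-snoc r x∉A e)

  walk-++ : ∀ {A u x z} → Walk G A u x → x ∉ A → Walk G A x z → Walk G A u z
  walk-++ stay           x∉A r = r
  walk-++ (edge e)       x∉A r = via e x∉A r
  walk-++ (via e y∉A r′) x∉A r = via e y∉A (walk-++ r′ x∉A r)

  walk-reverse : ∀ {A u w} → Walk G A u w → Walk G A w u
  walk-reverse stay          = stay
  walk-reverse (edge e)      = edge (E-sym e)
  walk-reverse (via e y∉A r) = walk-snoc (walk-reverse r) y∉A (E-sym e)

  InComp-sym : ∀ {A u w} → InComp G A u w → InComp G A w u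
  InComp-sym (u∉A , w∉A , r) = w∉A , u∉A , walk-reverse r

  InComp-trans : ∀ {A u w z} → InComp G A u w → InComp G A w z → InComp G A u z
  InComp-trans (u∉A , w∉A , r) (_ , z∉A , r′) = u∉A , z∉A , walk-++ r w∉A r′

  InComp-⊇ : ∀ {A B u w} → B ⊆ A → InComp G A u w → InComp G B u w
  InComp-⊇ B⊆A (u∉A , w∉A , r) = u∉A ∘ B⊆A , w∉A ∘ B⊆A , walk-⊇ B⊆A r

  module _ (A : Subset n) (t : Fin n) where

    Step : Subset n → Fin n → Set
    Step R z = z ∉ A × ∃ λ x → x ∈ R × E x z

    step? : ∀ R → Decidable (Step R)
    step? R z = ¬? (z ∈? A) ×-dec any? (λ x → (x ∈? R) ×-dec E-dec x z)

    ball : ℕ → Subset n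
    ball zero    = ⁅ t ⁆
    ball (suc i) = ball i ∪ fromDec (step? (ball i))

    ball-⊆ : ∀ i → ball i ⊆ ball (suc i)
    ball-⊆ i = x∈p∪q⁺ ∘ inj₁

    t∈ball : ∀ i → t ∈ ball i
    t∈ball zero    = x∈⁅x⁆ t
    t∈ball (suc i) = ball-⊆ i (t∈ball i)

    ball-step : ∀ i {x z} → x ∈ ball i → E x z → z ∉ A → z ∈ ball (suc i)
    ball-step i x∈ e z∉A = x∈p∪q⁺ (inj₂ (∈-fromDec⁺ (step? _) (z∉A , _ , x∈ , e)))

    ball-sound : ∀ i {z} → z ∈ ball i → z ≡ t ⊎ (z ∉ A × Walk G A t z)
    ball-sound zero    z∈ = inj₁ (x∈⁅y⁆⇒x≡y t z∈)
    ball-sound (suc i) z∈ with x∈p∪q⁻ (ball i) _ z∈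
    ... | inj₁ z∈ball = ball-sound i z∈ball
    ... | inj₂ z∈step with ∈-fromDec⁻ (step? _) z∈step
    ...   | z∉A , x , x∈ , e with ball-sound i x∈
    ...     | inj₁ refl       = inj₂ (z∉A , edge e)
    ...     | inj₂ (x∉A , r)  = inj₂ (z∉A , walk-snoc r x∉A e)

    Stable : Set
    Stable = ∃ λ j → ball (suc j) ⊆ ball j

    stable-or-large : ∀ i → Stable ⊎ suc i ≤ ∣ ball i ∣
    stable-or-large zero = inj₂ (≤-reflexive (sym (∣⁅x⁆∣≡1 t)))
    stable-or-large (suc i) with stable-or-large i
    ... | inj₁ s     = inj₁ s
    ... | inj₂ large with any? (λ z → (z ∈? ball (suc i)) ×-dec ¬? (z ∈? ball i))
    ...   | yes (z , new , old) = inj₂ (<-≤-trans (s≤s large) (p⊂q⇒∣p∣<∣q∣ (ball-⊆ i , z , new , old)))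
    ...   | no  nothing-new     =
      inj₁ (i , λ {z} z∈ → decidable-stable (z ∈? ball i) (λ z∉ → nothing-new (z , z∈ , z∉)))

    stable : Stable
    stable with stable-or-large n
    ... | inj₁ s     = s
    ... | inj₂ large = ⊥-elim (<⇒≱ large (∣p∣≤n (ball n)))

    component : Subset n
    component = ball (proj₁ stable)

    t∈component : t ∈ component
    t∈component = t∈ball (proj₁ stable)

    component-closed : ∀ {x z} → x ∈ component → Walk G A x z → z ∉ A → z ∈ component
    component-closed x∈ stay          z∉A = x∈
    component-closed x∈ (edge e)      z∉A = proj₂ stable (ball-step (proj₁ stable) x∈ e z∉A)
    component-closed x∈ (via e y∉A r) z∉A = component-closed (component-closed x∈ (edge e) y∉A) r z∉A

    ∈component⇒InComp : t ∉ A → ∀ {z} → z ∈ component → InComp G A t z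
    ∈component⇒InComp t∉A z∈ with ball-sound (proj₁ stable) z∈
    ... | inj₁ refl       = t∉A , t∉A , stay
    ... | inj₂ (z∉A , r)  = t∉A , z∉A , r

    InComp⇒∈component : ∀ {z} → InComp G A t z → z ∈ component
    InComp⇒∈component (_ , z∉A , r) = component-closed t∈component r z∉A

    InComp? : Decidable (InComp G A t)
    InComp? z = map′ (λ (t∉A , z∈) → ∈component⇒InComp t∉A z∈) (λ ic → proj₁ ic , InComp⇒∈component ic)
                     (¬? (t ∈? A) ×-dec (z ∈? component))

    root : Fin n
    root = first component (t , t∈component)

    InComp-root : t ∉ A → InComp G A t root
    InComp-root t∉A = ∈component⇒InComp t∉A (first-∈ component _)

  root-InComp : ∀ {A t} → t ∉ A → InComp G A (root A t) t
  root-InComp {A} {t} t∉A = InComp-sym (InComp-root A t t∉A)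

  component-cong : ∀ {A t t′} → InComp G A t t′ → component A t ≡ component A t′
  component-cong {A} {t} {t′} ic = ⊆-antisym
    (λ z∈ → InComp⇒∈component A t′ (InComp-trans (InComp-sym ic) (∈component⇒InComp A t (proj₁ ic) z∈)))
    (λ z∈ → InComp⇒∈component A t (InComp-trans ic (∈component⇒InComp A t′ (proj₁ (proj₂ ic)) z∈)))

  root-cong : ∀ {A t t′} → InComp G A t t′ → root A t ≡ root A t′
  root-cong ic = first-cong _ _ (component-cong ic)

infix 4 _⊑_

_⊑_ : ∀ {A : Set} → List A → List A → Set
xs ⊑ ys = ∃ λ zs → xs ++ zs ≡ ys

module _ {A : Set} where

  ⊑-refl : ∀ {xs : List A} → xs ⊑ xs
  ⊑-refl {xs} = [] , ++-identityʳ xs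

  ⊑-trans : ∀ {xs ys zs : List A} → xs ⊑ ys → ys ⊑ zs → xs ⊑ zs
  ⊑-trans {xs} (M , refl) (M′ , refl) = M ++ M′ , sym (++-assoc xs M M′)

  ⊑-++ : ∀ {xs : List A} ys → xs ⊑ xs ++ ys
  ⊑-++ ys = ys , refl

  ⊑-antisym : ∀ {xs ys : List A} → xs ⊑ ys → ys ⊑ xs → xs ≡ ys
  ⊑-antisym {xs} {ys} (M , xsM≡ys) (M′ , ysM′≡xs) = begin
    xs       ≡⟨ ++-identityʳ xs ⟨
    xs ++ [] ≡⟨ cong (xs ++_) (sym M≡[]) ⟩
    xs ++ M  ≡⟨ xsM≡ys ⟩
    ys       ∎
    where
    open ≡-Reasoning
    M≡[] : M ≡ []
    M≡[] = ++-conicalˡ M M′ (++-identityʳ-unique xs (sym (begin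
      xs ++ M ++ M′   ≡⟨ ++-assoc xs M M′ ⟨
      (xs ++ M) ++ M′ ≡⟨ cong (_++ M′) xsM≡ys ⟩
      ys ++ M′        ≡⟨ ysM′≡xs ⟩
      xs              ∎)))

  ∷-⊑ : ∀ {x} {xs ys : List A} → xs ⊑ ys → x ∷ xs ⊑ x ∷ ys
  ∷-⊑ {x} (M , eq) = M , cong (x ∷_) eq

  ⊑-comparable : ∀ {xs ys zs : List A} → xs ⊑ zs → ys ⊑ zs → xs ⊑ ys ⊎ ys ⊑ xs
  ⊑-comparable {[]}     {ys}     _          _        = inj₁ (ys , refl)
  ⊑-comparable {x ∷ xs} {[]}     _          _        = inj₂ (x ∷ xs , refl)
  ⊑-comparable {x ∷ xs} {y ∷ ys} (M , refl) (M′ , eq) with ∷-injective eq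
  ... | refl , eq′ = Sum.map ∷-⊑ ∷-⊑ (⊑-comparable (M , refl) (M′ , eq′))

  ⊑-∷ʳ⁻ : ∀ {xs ys : List A} {y} → xs ⊑ ys ∷ʳ y → xs ⊑ ys ⊎ xs ≡ ys ∷ʳ y
  ⊑-∷ʳ⁻ {xs} (M , eq) with initLast M
  ... | []        = inj₂ (trans (sym (++-identityʳ xs)) eq)
  ... | M₀ ∷ʳ′ z  = inj₁ (M₀ , proj₁ (∷ʳ-injective (xs ++ M₀) _ (trans (++-assoc xs M₀ (z ∷ [])) eq)))

  ∈-⊑ : ∀ {x} {xs ys : List A} → x ∈ₗ xs → xs ⊑ ys → x ∈ₗ ys
  ∈-⊑ x∈ (M , refl) = ∈-++⁺ˡ x∈

  ⊑-map : ∀ {B : Set} (f : A → B) {xs ys : List A} → xs ⊑ ys → map f xs ⊑ map f ys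
  ⊑-map f {xs} (M , refl) = map f M , sym (map-++ f xs M)

  last-∷ʳ : ∀ xs (x : A) → last (xs ∷ʳ x) ≡ just x
  last-∷ʳ []           x = refl
  last-∷ʳ (_ ∷ [])     x = refl
  last-∷ʳ (_ ∷ y ∷ xs) x = last-∷ʳ (y ∷ xs) x

Vertex′ : ℕ → ℕ → Set
Vertex′ n k = Fin n ⊎ Fin k

module _ {n k : ℕ} where

  infix 4 _∈′_
  infixl 6 _-′_

  _∈′_ : Vertex′ n k → CopPos n k → Set
  inj₁ a ∈′ X = a ∈ inG X
  inj₂ j ∈′ X = j ∈ inK X

  _-′_ : CopPos n k → Vertex′ n k → CopPos n k
  X -′ inj₁ a = cops (inG X - a) (inK X)
  X -′ inj₂ j = cops (inG X) (inK X - j)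

  insertG : Fin n → CopPos n k → CopPos n k
  insertG a X = cops (⁅ a ⁆ ∪ inG X) (inK X)

  ∈′-⁺ : ∀ {x y X} → x ∈′ X → x ≢ y → x ∈′ X -′ y
  ∈′-⁺ {inj₁ a} {inj₁ b} x∈ x≢y = x∈p∧x≢y⇒x∈p-y x∈ (x≢y ∘ cong inj₁)
  ∈′-⁺ {inj₁ a} {inj₂ j} x∈ x≢y = x∈
  ∈′-⁺ {inj₂ i} {inj₁ b} x∈ x≢y = x∈
  ∈′-⁺ {inj₂ i} {inj₂ j} x∈ x≢y = x∈p∧x≢y⇒x∈p-y x∈ (x≢y ∘ cong inj₂)

  ∈′-⁻ : ∀ {x y X} → x ∈′ X -′ y → x ∈′ X × x ≢ y
  ∈′-⁻ {inj₁ a} {inj₁ b} {X} x∈ = p─q⊆p (inG X) ⁅ b ⁆ x∈ , x∈p-y⇒x≢y (inG X) x∈ ∘ inj₁-injective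
  ∈′-⁻ {inj₁ a} {inj₂ j} x∈ = x∈ , λ ()
  ∈′-⁻ {inj₂ i} {inj₁ b} x∈ = x∈ , λ ()
  ∈′-⁻ {inj₂ i} {inj₂ j} {X} x∈ = p─q⊆p (inK X) ⁅ j ⁆ x∈ , x∈p-y⇒x≢y (inK X) x∈ ∘ inj₂-injective

  size-′ : ∀ {y} (X : CopPos n k) → y ∈′ X → suc (size (X -′ y)) ≡ size X
  size-′ {inj₁ a} X y∈ = cong (_+ ∣ inK X ∣) (1+∣p-x∣≡∣p∣ (inG X) y∈)
  size-′ {inj₂ j} X y∈ = trans (sym (+-suc ∣ inG X ∣ _)) (cong (∣ inG X ∣ +_) (1+∣p-x∣≡∣p∣ (inK X) y∈))

  ∈′-insertG : ∀ {x a} {X : CopPos n k} → x ∈′ X → x ∈′ insertG a X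
  ∈′-insertG {inj₁ _} x∈ = x∈p∪q⁺ (inj₂ x∈)
  ∈′-insertG {inj₂ _} x∈ = x∈

  size-insertG : ∀ {a} (X : CopPos n k) → a ∉ inG X → size (insertG a X) ≡ suc (size X)
  size-insertG {a} X a∉ = cong (_+ ∣ inK X ∣) (∣⁅x⁆∪p∣≡1+∣p∣ a (inG X) a∉)

module ForestFacts {n : ℕ} (F : RootedForest n) where
  open RootedForest F

  ≺-≼-trans : ∀ {a b c} → a ≺ b → b ≼ c → a ≺ c
  ≺-≼-trans (a≼b , a≢b) b≼c = ≼-trans a≼b b≼c , λ { refl → a≢b (≼-antisym a≼b b≼c) }

  ≺-trans : ∀ {a b c} → a ≺ b → b ≺ c → a ≺ c
  ≺-trans a≺b b≺c = ≺-≼-trans a≺b (proj₁ b≺c)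

  _≺?_ : ∀ a b → Dec (a ≺ b)
  a ≺? b = ≼-dec a b ×-dec ¬? (a ≟ᶠ b)

  [_]-isChain : ∀ x → IsChain (x ∷ [])
  [ x ]-isChain = [] ∷ [] , [] ∷ []

  ∷-isChain : ∀ {z xs} → IsChain xs → All (λ d → d ≺ z ⊎ z ≺ d) xs → IsChain (z ∷ xs)
  ∷-isChain (unique , comparable) strict =
    All.map distinct strict ∷ unique , All.map comparable-with strict ∷ comparable
    where
    distinct : ∀ {d z} → d ≺ z ⊎ z ≺ d → z ≢ d
    distinct (inj₁ (_ , d≢z)) = d≢z ∘ sym
    distinct (inj₂ (_ , z≢d)) = z≢d
    comparable-with : ∀ {d z} → d ≺ z ⊎ z ≺ d → Comparable z d
    comparable-with (inj₁ (d≼z , _)) = inj₂ d≼z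
    comparable-with (inj₂ (z≼d , _)) = inj₁ z≼d

  ∃-greatest : ∀ {x xs} → AllPairs Comparable (x ∷ xs) → ∃ λ m → m ∈ₗ x ∷ xs × All (_≼ m) (x ∷ xs)
  ∃-greatest {x} {[]}     _             = x , here refl , ≼-refl ∷ []
  ∃-greatest {x} {_ ∷ xs} (x~xs ∷ rest) with ∃-greatest rest
  ... | m , m∈ , ≼m with All.lookup x~xs m∈
  ...   | inj₁ x≼m = m , there m∈ , x≼m ∷ ≼m
  ...   | inj₂ m≼x = x , here refl , ≼-refl ∷ All.map (λ y≼m → ≼-trans y≼m m≼x) ≼m

  module _ {h : ℕ} (height : HeightAtMost h) {P : Fin n → Set} (P? : Decidable P) where

    Minimal : Fin n → Set
    Minimal m = P m × (∀ {b} → P b → b ≺ m → ⊥)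

    private
      descend : ∀ fuel {x} D → P x → IsChain (x ∷ D) → All (x ≼_) D → h ≤ length D + fuel → ∃ Minimal
      descend fuel {x} D px chain above budget with any? (λ z → P? z ×-dec z ≺? x)
      ... | no  none = x , px , λ pb b≺x → none (_ , pb , b≺x)
      descend zero D _ chain _ budget | yes _ =
        ⊥-elim (1+n≰n (≤-trans (height _ chain) (≤-trans budget (≤-reflexive (+-identityʳ _)))))
      descend (suc fuel) {x} D _ chain above budget | yes (z , pz , z≺x) =
        descend fuel (x ∷ D) pz (∷-isChain chain (inj₂ z≺x ∷ All.map (inj₂ ∘ ≺-≼-trans z≺x) above))
          (proj₁ z≺x ∷ All.map (≼-trans (proj₁ z≺x)) above) (≤-trans budget (≤-reflexive (+-suc _ fuel)))

    ∃-minimal : ∀ {x} → P x → ∃ Minimal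
    ∃-minimal px = descend h [] px [ _ ]-isChain [] ≤-refl

  module _ {h : ℕ} (height : HeightAtMost h) where

    ∃-root≼ : ∀ v → ∃ λ ρ → ρ ≼ v × (∀ {b} → b ≺ ρ → ⊥)
    ∃-root≼ v with ∃-minimal height (λ z → ≼-dec z v) ≼-refl
    ... | ρ , ρ≼v , minimal = ρ , ρ≼v , λ b≺ρ → minimal (≼-trans (proj₁ b≺ρ) ρ≼v) b≺ρ

    ∃-child≼ : ∀ {w v} → w ≺ v → ∃ λ c → w ≺ c × c ≼ v × (∀ {b} → w ≺ b → b ≺ c → ⊥)
    ∃-child≼ {w} {v} w≺v with ∃-minimal height (λ z → (w ≺? z) ×-dec ≼-dec z v) (w≺v , ≼-refl)
    ... | c , (w≺c , c≼v) , minimal =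
      c , w≺c , c≼v , λ w≺b b≺c → minimal (w≺b , ≼-trans (proj₁ b≺c) c≼v) b≺c

-- From a forest cover to a winning strategy

module CoverStrategy {n : ℕ} (G : Graph n) (k q : ℕ) (C : PebbleForestCover G k q) where
  open Graph G
  open PebbleForestCover C
  open RootedForest F
  open ForestFacts F

  -- pos j is where the cop carrying pebble j stands; an unused pebble j stays on the j-th vertex of K.
  Placement : Set
  Placement = Fin k → Vertex′ n k

  record Invariant (w : Fin n) (X : CopPos n k) (pos : Placement) : Set where
    field
      occupied : ∀ j → pos j ∈′ X
      size≡k   : size X ≡ k
      below    : ∀ {x} → x ∈ inG X → x ≺ w
      guarded  : ∀ {b y} → b ≺ w → w ≼ y → E b y → pos (p b) ≡ inj₁ b
      pebbled  : ∀ {j a} → pos j ≡ inj₁ a → p a ≡ j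
      unused   : ∀ {j m} → pos j ≡ inj₂ m → m ≡ j

  module Round {w : Fin n} {X : CopPos n k} {pos : Placement} (inv : Invariant w X pos) where
    open Invariant inv

    y : Vertex′ n k
    y = pos (p w)

    X′ : CopPos n k
    X′ = insertG w (X -′ y)

    pos′ : Placement
    pos′ = updateAt pos (p w) (const (inj₁ w))

    pos′-cases : ∀ j → (j ≡ p w × pos′ j ≡ inj₁ w) ⊎ (j ≢ p w × pos′ j ≡ pos j)
    pos′-cases j with j ≟ᶠ p w
    ... | yes refl = inj₁ (refl , updateAt-updates (p w) pos)
    ... | no  j≢pw = inj₂ (j≢pw , updateAt-minimal j (p w) pos j≢pw)

    pos-injective : ∀ {i j} → pos i ≡ pos j → i ≡ j
    pos-injective {i} {j} eq with pos i in eqᵢ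
    ... | inj₁ a = trans (sym (pebbled eqᵢ)) (pebbled (sym eq))
    ... | inj₂ m = trans (sym (unused eqᵢ)) (unused (sym eq))

    ∉X : ∀ {z} → w ≼ z → z ∉ inG X
    ∉X w≼z z∈X = proj₂ (below z∈X) (≼-antisym (proj₁ (below z∈X)) w≼z)

    w∉X-y : w ∉ inG (X -′ y)
    w∉X-y w∈ = ∉X ≼-refl (proj₁ (∈′-⁻ {x = inj₁ w} {y = y} w∈))

    w∈X′ : w ∈ inG X′
    w∈X′ = x∈p∪q⁺ (inj₁ (x∈⁅x⁆ w))

    X∩X′≡X-y : X ∩ᶜ X′ ≡ X -′ y
    X∩X′≡X-y = cong₂ cops
      (⊆-antisym G⊆ (λ z∈ → x∈p∩q⁺ (proj₁ (∈′-⁻ {x = inj₁ _} {y = y} z∈) , x∈p∪q⁺ (inj₂ z∈))))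
      (⊆-antisym (p∩q⊆q _ _) (λ z∈ → x∈p∩q⁺ (proj₁ (∈′-⁻ {x = inj₂ _} {y = y} z∈) , z∈)))
      where
      G⊆ : inG X ∩ inG X′ ⊆ inG (X -′ y)
      G⊆ z∈ with x∈p∩q⁻ (inG X) (inG X′) z∈
      ... | z∈X , z∈X′ with x∈p∪q⁻ ⁅ w ⁆ _ z∈X′
      ...   | inj₁ z∈⁅w⁆ = contradiction (subst (_∈ inG X) (x∈⁅y⁆⇒x≡y w z∈⁅w⁆) z∈X) (∉X ≼-refl)
      ...   | inj₂ z∈X-y = z∈X-y

    size-X′ : size X′ ≡ k
    size-X′ = trans (size-insertG (X -′ y) w∉X-y) (trans (size-′ X (occupied (p w))) size≡k)

    size-X∩X′ : size (X ∩ᶜ X′) ≡ k ∸ 1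
    size-X∩X′ = trans (cong size X∩X′≡X-y) (cong (_∸ 1) (trans (size-′ X (occupied (p w))) size≡k))

    guard-kept : ∀ {b y′} → b ≺ w → w ≼ y′ → E b y′ → b ∈ inG (X ∩ᶜ X′)
    guard-kept {b} b≺w w≼y′ e = subst (λ Z → b ∈ inG Z) (sym X∩X′≡X-y) (∈′-⁺ {x = inj₁ b} {y = y} b∈X b≢y)
      where
      b∈X : b ∈ inG X
      b∈X = subst (_∈′ X) (guarded b≺w w≼y′ e) (occupied (p b))
      b≢y : inj₁ b ≢ y
      b≢y b≡y = pebbles e (≺-≼-trans b≺w w≼y′) b≺w w≼y′ (sym (pebbled (sym b≡y)))

    step-trapped : ∀ {a z} → w ≼ a → E a z → z ∉ inG (X ∩ᶜ X′) → w ≼ z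
    step-trapped {a} {z} w≼a e z∉ with edges e
    ... | inj₁ a≼z = ≼-trans w≼a a≼z
    ... | inj₂ z≼a with ≼-forest z≼a w≼a
    ...   | inj₂ w≼z = w≼z
    ...   | inj₁ z≼w with z ≟ᶠ w
    ...     | yes refl = ≼-refl
    ...     | no  z≢w  = contradiction (guard-kept (z≼w , z≢w) w≼a (E-sym e)) z∉

    trapped : ∀ {a z} → w ≼ a → Walk G (inG (X ∩ᶜ X′)) a z → z ∉ inG (X ∩ᶜ X′) →
              w ≼ z × Walk G (inG X) a z
    trapped w≼a stay           z∉ = w≼a , stay
    trapped w≼a (edge e)       z∉ = step-trapped w≼a e z∉ , edge e
    trapped w≼a (via e x∉ r)   z∉ with trapped (step-trapped w≼a e x∉) r z∉
    ... | w≼z , r′ = w≼z , via e (∉X (step-trapped w≼a e x∉)) r′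

    escaped : ∀ {v v′} → w ≼ v → Walk G (inG (X ∩ᶜ X′)) v v′ → v′ ∉ inG X′ → w ≺ v′
    escaped w≼v walk v′∉X′ =
      proj₁ (trapped w≼v walk (v′∉X′ ∘ proj₂ ∘ x∈p∩q⁻ (inG X) (inG X′))) , λ { refl → v′∉X′ w∈X′ }

    legal : ∀ {v} → w ≼ v → v ∉ inG X → LegalMove G k X v X′
    legal {v} w≼v v∉X = size-X′ , size-X∩X′ , monotone
      where
      monotone : ∀ z → InComp G (inG (X ∩ᶜ X′)) v z → InComp G (inG X) v z
      monotone z (_ , z∉ , r) = v∉X , ∉X (proj₁ (trapped w≼v r z∉)) , proj₂ (trapped w≼v r z∉)

    next-invariant : ∀ {c} → w ≺ c → (∀ {b} → w ≺ b → b ≺ c → ⊥) → Invariant c X′ pos′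
    next-invariant {c} w≺c child = record
      { occupied = occupied′
      ; size≡k   = size-X′
      ; below    = below′
      ; guarded  = guarded′
      ; pebbled  = pebbled′
      ; unused   = unused′
      }
      where
      occupied′ : ∀ j → pos′ j ∈′ X′
      occupied′ j with pos′-cases j
      ... | inj₁ (_ , eq)     = subst (_∈′ X′) (sym eq) w∈X′
      ... | inj₂ (j≢pw , eq)  = subst (_∈′ X′) (sym eq)
            (∈′-insertG {x = pos j} (∈′-⁺ {x = pos j} {y = y} (occupied j) (j≢pw ∘ pos-injective)))

      below′ : ∀ {x} → x ∈ inG X′ → x ≺ c
      below′ x∈ with x∈p∪q⁻ ⁅ w ⁆ _ x∈
      ... | inj₁ x∈⁅w⁆ = subst (_≺ c) (sym (x∈⁅y⁆⇒x≡y w x∈⁅w⁆)) w≺c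
      ... | inj₂ x∈X-y = ≺-trans (below (proj₁ (∈′-⁻ {x = inj₁ _} {y = y} x∈X-y))) w≺c

      guarded′ : ∀ {b y′} → b ≺ c → c ≼ y′ → E b y′ → pos′ (p b) ≡ inj₁ b
      guarded′ {b} {y′} b≺c c≼y′ e with b ≟ᶠ w
      ... | yes refl = updateAt-updates (p w) pos
      ... | no  b≢w with ≼-forest (proj₁ b≺c) (proj₁ w≺c)
      ...   | inj₂ w≼b = ⊥-elim (child (w≼b , b≢w ∘ sym) b≺c)
      ...   | inj₁ b≼w = trans (updateAt-minimal (p b) (p w) pos (pw≢pb ∘ sym)) (guarded (b≼w , b≢w) w≼y′ e)
        where
        w≼y′ : w ≼ y′
        w≼y′ = ≼-trans (proj₁ w≺c) c≼y′
        pw≢pb : p w ≢ p b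
        pw≢pb = pebbles e (≺-≼-trans (b≼w , b≢w) w≼y′) (b≼w , b≢w) w≼y′

      pebbled′ : ∀ {j a} → pos′ j ≡ inj₁ a → p a ≡ j
      pebbled′ {j} eq′ with pos′-cases j
      ... | inj₁ (j≡pw , eq) = trans (cong p (inj₁-injective (trans (sym eq′) eq))) (sym j≡pw)
      ... | inj₂ (_ , eq)    = pebbled (trans (sym eq) eq′)

      unused′ : ∀ {j m} → pos′ j ≡ inj₂ m → m ≡ j
      unused′ {j} eq′ with pos′-cases j
      ... | inj₁ (_ , eq) = contradiction (trans (sym eq) eq′) λ ()
      ... | inj₂ (_ , eq) = unused (trans (sym eq) eq′)

  game : ∀ r (L : List (Fin n)) {w X pos v} → Invariant w X pos →
         IsChain (w ∷ L) → All (_≺ w) L → q ≤ length L + suc r →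
         w ≼ v → v ∉ inG X → CopsWin G k (suc r) X v
  game r L {w} {X} {v = v} inv chain L≺w budget w≼v v∉X = X′ , legal w≼v v∉X , respond
    where
    open Round inv

    respond : ∀ v′ → Walk G (inG (X ∩ᶜ X′)) v v′ → v′ ∈ inG X′ ⊎ CopsWin G k r X′ v′
    respond v′ walk with v′ ∈? inG X′
    ... | yes caught = inj₁ caught
    ... | no  v′∉X′ with ∃-child≼ depth (escaped w≼v walk v′∉X′)
    ...   | c , w≺c , c≼v′ , child = inj₂ (continue r budget)
      where
      w∷L≺c : All (_≺ c) (w ∷ L)
      w∷L≺c = w≺c ∷ All.map (λ d≺w → ≺-trans d≺w w≺c) L≺w

      chain′ : IsChain (c ∷ w ∷ L)
      chain′ = ∷-isChain chain (All.map inj₁ w∷L≺c)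

      continue : ∀ r → q ≤ length L + suc r → CopsWin G k r X′ v′
      continue zero    budget =
        ⊥-elim (1+n≰n (≤-trans (depth _ chain′) (≤-trans budget (≤-reflexive (+-comm (length L) 1)))))
      continue (suc r) budget = game r (w ∷ L) (next-invariant w≺c child) chain′ w∷L≺c
                                  (≤-trans budget (≤-reflexive (+-suc (length L) (suc r)))) c≼v′ v′∉X′

  cover⇒copsWin : 1 ≤ q → CopsWinsMonCR G k q
  cover⇒copsWin (s≤s {n = r} z≤n) v with ∃-root≼ depth v
  ... | ρ , ρ≼v , root = game r [] initial [ ρ ]-isChain [] ≤-refl ρ≼v ∉⊥
    where
    initial : Invariant ρ onK inj₂
    initial = record
      { occupied = λ _ → ∈⊤
      ; size≡k   = cong₂ _+_ (∣⊥∣≡0 n) (∣⊤∣≡n k)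
      ; below    = λ x∈ → contradiction x∈ ∉⊥
      ; guarded  = λ b≺ρ _ _ → ⊥-elim (root b≺ρ)
      ; pebbled  = λ ()
      ; unused   = λ eq → sym (inj₂-injective eq)
      }

-- From a winning strategy to a forest cover

module LegalMoves {n : ℕ} (G : Graph n) (k : ℕ) where
  open Graph G
  open Components G

  at-most-one-new : ∀ {X v X′ a b} → LegalMove G k X v X′ →
                    a ∈ inG X′ → a ∉ inG X → b ∈ inG X′ → b ∉ inG X → a ≡ b
  at-most-one-new {X} {v} {X′} {a} {b} (size-X′ , size-X∩X′ , _) a∈X′ a∉X b∈X′ b∉X with a ≟ᶠ b
  ... | yes a≡b = a≡b
  ... | no  a≢b = ⊥-elim (1+n≰n (begin
    2 + (k ∸ 1)                             ≡⟨ cong (2 +_) size-X∩X′ ⟨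
    2 + (∣ S ∣ + ∣ inK (X ∩ᶜ X′) ∣)        ≤⟨ +-mono-≤ two-more (∣p∩q∣≤∣q∣ (inK X) (inK X′)) ⟩
    size X′                                 ≡⟨ size-X′ ⟩
    k                                       ≤⟨ m≤n+m∸n k 1 ⟩
    1 + (k ∸ 1)                             ∎))
    where
    open ≤-Reasoning
    S : Subset n
    S = inG (X ∩ᶜ X′)

    ∉S : ∀ {z} → z ∉ inG X → z ∉ S
    ∉S z∉X = z∉X ∘ proj₁ ∘ x∈p∩q⁻ (inG X) (inG X′)

    b∉⁅a⁆∪S : b ∉ ⁅ a ⁆ ∪ S
    b∉⁅a⁆∪S b∈ with x∈p∪q⁻ ⁅ a ⁆ S b∈
    ... | inj₁ b∈⁅a⁆ = a≢b (sym (x∈⁅y⁆⇒x≡y a b∈⁅a⁆))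
    ... | inj₂ b∈S   = ∉S b∉X b∈S

    ⊆X′ : ⁅ b ⁆ ∪ (⁅ a ⁆ ∪ S) ⊆ inG X′
    ⊆X′ z∈ with x∈p∪q⁻ ⁅ b ⁆ _ z∈
    ... | inj₁ z∈⁅b⁆ = subst (_∈ inG X′) (sym (x∈⁅y⁆⇒x≡y b z∈⁅b⁆)) b∈X′
    ... | inj₂ z∈′ with x∈p∪q⁻ ⁅ a ⁆ S z∈′
    ...   | inj₁ z∈⁅a⁆ = subst (_∈ inG X′) (sym (x∈⁅y⁆⇒x≡y a z∈⁅a⁆)) a∈X′
    ...   | inj₂ z∈S   = proj₂ (x∈p∩q⁻ (inG X) (inG X′) z∈S)

    two-more : suc (suc ∣ S ∣) ≤ ∣ inG X′ ∣
    two-more = begin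
      suc (suc ∣ S ∣)               ≡⟨ cong suc (∣⁅x⁆∪p∣≡1+∣p∣ a S (∉S a∉X)) ⟨
      suc ∣ ⁅ a ⁆ ∪ S ∣             ≡⟨ ∣⁅x⁆∪p∣≡1+∣p∣ b _ b∉⁅a⁆∪S ⟨
      ∣ ⁅ b ⁆ ∪ (⁅ a ⁆ ∪ S) ∣       ≤⟨ p⊆q⇒∣p∣≤∣q∣ ⊆X′ ⟩
      ∣ inG X′ ∣                    ∎

  adjacent-cop-stays : ∀ {X c X′ u v} → LegalMove G k X c X′ → InComp G (inG X) c v →
                       u ∈ inG X → E u v → u ∈ inG X′
  adjacent-cop-stays {X} {c} {X′} {u} {v} (_ , _ , monotone) (c∉X , v∉X , c⇝v) u∈X e with u ∈? inG X′
  ... | yes u∈X′ = u∈X′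
  ... | no  u∉X′ = contradiction u∈X (proj₁ (proj₂ (monotone u (∉I c∉X , ∉I′ u∉X′ ,
                     walk-snoc (walk-⊇ (p∩q⊆p (inG X) (inG X′)) c⇝v) (∉I v∉X) (E-sym e)))))
    where
    ∉I : ∀ {z} → z ∉ inG X → z ∉ inG (X ∩ᶜ X′)
    ∉I z∉ = z∉ ∘ proj₁ ∘ x∈p∩q⁻ (inG X) (inG X′)
    ∉I′ : ∀ {z} → z ∉ inG X′ → z ∉ inG (X ∩ᶜ X′)
    ∉I′ z∉ = z∉ ∘ proj₂ ∘ x∈p∩q⁻ (inG X) (inG X′)

  InComp-∩-root : ∀ {X X′ : CopPos n k} {c t} → InComp G (inG X) c t → t ∉ inG X′ →
                  InComp G (inG (X ∩ᶜ X′)) c (root (inG X′) t)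
  InComp-∩-root {X} {X′} {c} {t} c⇝t t∉X′ =
    InComp-trans (InComp-⊇ (p∩q⊆p (inG X) (inG X′)) c⇝t)
                 (InComp-⊇ (p∩q⊆q (inG X) (inG X′)) (InComp-root (inG X′) t t∉X′))

  new-component⊆old : ∀ {X X′ c c′ z} → LegalMove G k X c X′ → InComp G (inG (X ∩ᶜ X′)) c c′ →
                      InComp G (inG X′) c′ z → InComp G (inG X) c z
  new-component⊆old {X} {X′} (_ , _ , monotone) (c∉ , c′∉ , c⇝c′) (_ , z∉X′ , c′⇝z) =
    monotone _ (c∉ , z∉X′ ∘ proj₂ ∘ x∈p∩q⁻ (inG X) (inG X′) ,
                walk-++ c⇝c′ c′∉ (walk-⊇ (p∩q⊆q (inG X) (inG X′)) c′⇝z))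

module StrategyCover {n : ℕ} (G : Graph n) (k′ q : ℕ) (win : CopsWinsMonCR G (suc k′) q) where
  open Graph G
  open Components G
  open LegalMoves G (suc k′)

  k : ℕ
  k = suc k′

  History : Set
  History = List (Fin n × Fin k)

  V : History → List (Fin n)
  V = map proj₁

  Reply : ℕ → CopPos n k → CopPos n k → Fin n → Set
  Reply r X X′ c = ∀ v′ → Walk G (inG (X ∩ᶜ X′)) c v′ → v′ ∈ inG X′ ⊎ CopsWin G k r X′ v′

  labelsIn : Subset n → History → List (Fin k)
  labelsIn S []            = []
  labelsIn S ((u , l) ∷ h) with u ∈? S
  ... | yes _ = l ∷ labelsIn S h
  ... | no  _ = labelsIn S h

  ∈-labelsIn : ∀ {S u l h} → (u , l) ∈ₗ h → u ∈ S → l ∈ₗ labelsIn S h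
  ∈-labelsIn {S} {h = (u′ , _) ∷ _} (here refl) u∈S with u′ ∈? S
  ... | yes _   = here refl
  ... | no  u∉S = contradiction u∈S u∉S
  ∈-labelsIn {S} {h = (u′ , _) ∷ _} (there r∈h) u∈S with u′ ∈? S
  ... | yes _ = there (∈-labelsIn r∈h u∈S)
  ... | no  _ = ∈-labelsIn r∈h u∈S

  labelsIn-∖ : ∀ {S u} h → u ∉ₗ V h → labelsIn (S - u) h ≡ labelsIn S h
  labelsIn-∖ []            _   = refl
  labelsIn-∖ {S} {u} ((u′ , l′) ∷ h) u∉h with u′ ∈? S - u | u′ ∈? S
  ... | yes _       | yes _   = cong (l′ ∷_) (labelsIn-∖ h (u∉h ∘ there))
  ... | no  _       | no  _   = labelsIn-∖ h (u∉h ∘ there)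
  ... | yes u′∈S-u  | no u′∉S = contradiction (p─q⊆p S ⁅ u ⁆ u′∈S-u) u′∉S
  ... | no  u′∉S-u  | yes u′∈S =
    contradiction (x∈p∧x≢y⇒x∈p-y u′∈S (λ u′≡u → u∉h (here (sym u′≡u)))) u′∉S-u

  length-labelsIn : ∀ S h → Unique (V h) → length (labelsIn S h) ≤ ∣ S ∣
  length-labelsIn S []            _              = z≤n
  length-labelsIn S ((u , l) ∷ h) (u∉h ∷ unique) with u ∈? S
  ... | no  _   = length-labelsIn S h unique
  ... | yes u∈S = begin
    suc (length (labelsIn S h))        ≡⟨ cong (suc ∘ length) (labelsIn-∖ h (λ u∈ → All.lookup u∉h u∈ refl)) ⟨
    suc (length (labelsIn (S - u) h))  ≤⟨ s≤s (length-labelsIn (S - u) h unique) ⟩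
    suc ∣ S - u ∣                      ≡⟨ 1+∣p-x∣≡∣p∣ S u∈S ⟩
    ∣ S ∣                              ∎
    where open ≤-Reasoning

  NewIn : CopPos n k → CopPos n k → Fin n → Fin n → Set
  NewIn X X′ c z = z ∈ inG X′ × InComp G (inG X) c z

  label : CopPos n k → CopPos n k → History → Fin k
  label X X′ h = unlisted (labelsIn (inG (X ∩ᶜ X′)) h)

  newRecords : CopPos n k → CopPos n k → Fin n → History → History
  newRecords X X′ c h with any? (λ z → (z ∈? inG X′) ×-dec InComp? (inG X) c z)
  ... | yes (x , _) = (x , label X X′ h) ∷ []
  ... | no  _       = []

  data NewRecords (X X′ : CopPos n k) (c : Fin n) (h : History) : History → Set where
    none : (∀ {z} → ¬ NewIn X X′ c z) → NewRecords X X′ c h []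
    one  : ∀ {x} → NewIn X X′ c x → NewRecords X X′ c h ((x , label X X′ h) ∷ [])

  newRecords-view : ∀ X X′ c h → NewRecords X X′ c h (newRecords X X′ c h)
  newRecords-view X X′ c h with any? (λ z → (z ∈? inG X′) ×-dec InComp? (inG X) c z)
  ... | yes (_ , new) = one new
  ... | no  no-new    = none (λ new → no-new (_ , new))

  afterRound : CopPos n k → CopPos n k → Fin n → History → History
  afterRound X X′ c h = h ++ newRecords X X′ c h

  length-afterRound : ∀ X X′ c h → length (afterRound X X′ c h) ≤ suc (length h)
  length-afterRound X X′ c h with newRecords X X′ c h | newRecords-view X X′ c h
  ... | _ | none _ = ≤-trans (≤-reflexive (length-++ h)) (≤-trans (≤-reflexive (+-identityʳ _)) (n≤1+n _))
  ... | _ | one _  = ≤-reflexive (trans (length-++ h) (+-comm (length h) 1))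

  ∈-afterRound⁻ : ∀ {X X′ c h z} → z ∈ₗ V (afterRound X X′ c h) → z ∈ₗ V h ⊎ NewIn X X′ c z
  ∈-afterRound⁻ {X} {X′} {c} {h} z∈ with newRecords X X′ c h | newRecords-view X X′ c h
  ... | new | view with ∈-++⁻ (V h) (subst (_ ∈ₗ_) (map-++ proj₁ h new) z∈) | view
  ...   | inj₁ z∈h         | _       = inj₁ z∈h
  ...   | inj₂ (here refl) | one new = inj₂ new

  ∈-afterRound⁺ : ∀ {X v X′ c h z} → LegalMove G k X v X′ → NewIn X X′ c z → z ∈ₗ V (afterRound X X′ c h)
  ∈-afterRound⁺ {X} {v} {X′} {c} {h} legal (z∈X′ , c⇝z) with newRecords X X′ c h | newRecords-view X X′ c h
  ... | _ | none no-new = contradiction (z∈X′ , c⇝z) no-new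
  ... | _ | one (x∈X′ , c⇝x)
    rewrite at-most-one-new {X} {v} {X′} legal z∈X′ (proj₁ (proj₂ c⇝z)) x∈X′ (proj₁ (proj₂ c⇝x)) =
    subst (_ ∈ₗ_) (sym (map-++ proj₁ h _)) (∈-++⁺ʳ (V h) (here refl))

  resume : ∀ {r} X {X′ c} → Reply r X X′ c → ∀ c′ → Maybe (CopsWin G k r X′ c′)
  resume X {X′} {c} cont c′ with InComp? (inG (X ∩ᶜ X′)) c c′
  ... | no  _       = nothing
  ... | yes c⇝c′ with cont c′ (proj₂ (proj₂ c⇝c′))
  ...   | inj₁ _  = nothing
  ...   | inj₂ w′ = just w′

  resume-just : ∀ {r} X {X′ c c′} (cont : Reply r X X′ c) → InComp G (inG (X ∩ᶜ X′)) c c′ → c′ ∉ inG X′ →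
                ∃ λ w′ → resume X cont c′ ≡ just w′
  resume-just X {X′} {c} {c′} cont c⇝c′ c′∉X′ with InComp? (inG (X ∩ᶜ X′)) c c′
  ... | no  ¬c⇝c′ = contradiction c⇝c′ ¬c⇝c′
  ... | yes c⇝ᵈc′  with cont c′ (proj₂ (proj₂ c⇝ᵈc′))
  ...   | inj₁ c′∈X′ = contradiction c′∈X′ c′∉X′
  ...   | inj₂ w′    = w′ , refl

  -- The robber moves to the root of t's new component, so until t is caught the play depends on t
  -- only through its component.
  play : ∀ r {X c} → CopsWin G k r X c → Fin n → History → History
  play zero    ()
  play (suc r) {X} {c} (X′ , _ , cont) t h with t ∈? inG X′
  ... | yes _ = afterRound X X′ c h
  ... | no  _ =
    maybe′ (λ w′ → play r w′ t (afterRound X X′ c h)) (afterRound X X′ c h) (resume X cont (root (inG X′) t))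

  escapes : ∀ {r} X {X′ c t} (cont : Reply r X X′ c) → InComp G (inG X) c t → t ∉ inG X′ →
            ∃ λ w′ → resume X cont (root (inG X′) t) ≡ just w′
  escapes X {X′} {t = t} cont c⇝t t∉X′ =
    resume-just X cont (InComp-∩-root {X} {X′} c⇝t t∉X′) (proj₁ (proj₂ (InComp-root (inG X′) t t∉X′)))

  play-extends : ∀ r {X c} (w : CopsWin G k r X c) t h → h ⊑ play r w t h
  ⊑-resumed : ∀ r {X c} (m : Maybe (CopsWin G k r X c)) t h → h ⊑ maybe′ (λ w′ → play r w′ t h) h m
  afterRound-⊑-play : ∀ r {X c} (w : CopsWin G k (suc r) X c) t h →
                      afterRound X (proj₁ w) c h ⊑ play (suc r) {X} {c} w t h

  play-extends zero    ()
  play-extends (suc r) {X} {c} w t h = ⊑-trans (⊑-++ (newRecords X (proj₁ w) c h)) (afterRound-⊑-play r w t h)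

  ⊑-resumed r nothing   t h = ⊑-refl
  ⊑-resumed r (just w′) t h = play-extends r w′ t h

  afterRound-⊑-play r {X} {c} (X′ , _ , cont) t h with t ∈? inG X′
  ... | yes _ = ⊑-refl
  ... | no  _ = ⊑-resumed r (resume X cont (root (inG X′) t)) t _

  length-afterRound+ : ∀ X X′ c h r → length (afterRound X X′ c h) + r ≤ length h + suc r
  length-afterRound+ X X′ c h r =
    ≤-trans (+-monoˡ-≤ r (length-afterRound X X′ c h)) (≤-reflexive (sym (+-suc (length h) r)))

  play-length : ∀ r {X c} (w : CopsWin G k r X c) t h → length (play r w t h) ≤ length h + r
  length-resumed : ∀ r {X c} (m : Maybe (CopsWin G k r X c)) t h →
                   length (maybe′ (λ w′ → play r w′ t h) h m) ≤ length h + r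

  play-length zero    ()
  play-length (suc r) {X} {c} (X′ , _ , cont) t h with t ∈? inG X′
  ... | yes _ = ≤-trans (m≤m+n _ r) (length-afterRound+ X X′ c h r)
  ... | no  _ = ≤-trans (length-resumed r (resume X cont (root (inG X′) t)) t _) (length-afterRound+ X X′ c h r)

  length-resumed r nothing   t h = m≤m+n (length h) r
  length-resumed r (just w′) t h = play-length r w′ t h

  ∉-afterRound : ∀ {X X′ c h u} → u ∉ₗ V h → u ∉ inG X′ → u ∉ₗ V (afterRound X X′ c h)
  ∉-afterRound u∉h u∉X′ u∈ = Sum.[ u∉h , u∉X′ ∘ proj₁ ]′ (∈-afterRound⁻ u∈)

  afterRound-caught : ∀ {X c X′ t} h → LegalMove G k X c X′ → InComp G (inG X) c t → t ∈ inG X′ →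
                      afterRound X X′ c h ≡ h ∷ʳ (t , label X X′ h)
  afterRound-caught {X} {c} {X′} {t} h legal c⇝t t∈X′ with newRecords X X′ c h | newRecords-view X X′ c h
  ... | _ | none no-new         = contradiction (t∈X′ , c⇝t) no-new
  ... | _ | one (x∈X′ , c⇝x)
    rewrite at-most-one-new {X} {c} {X′} legal x∈X′ (proj₁ (proj₂ c⇝x)) t∈X′ (proj₁ (proj₂ c⇝t)) = refl

  play-vertices : ∀ r {X c} (w : CopsWin G k r X c) t h → InComp G (inG X) c t →
                  ∀ {z} → z ∈ₗ V (play r w t h) → z ∈ₗ V h ⊎ InComp G (inG X) c z
  play-vertices zero    ()
  play-vertices (suc r) {X} {c} (X′ , legal , cont) t h c⇝t z∈ with t ∈? inG X′
  ... | yes _     = Sum.map₂ proj₂ (∈-afterRound⁻ z∈)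
  ... | no  t∉X′ with resume X cont (root (inG X′) t) | escapes X cont c⇝t t∉X′
  ...   | .(just w′) | w′ , refl with play-vertices r w′ t (afterRound X X′ c h) (root-InComp t∉X′) z∈
  ...     | inj₁ z∈h′ = Sum.map₂ proj₂ (∈-afterRound⁻ z∈h′)
  ...     | inj₂ c′⇝z = inj₂ (new-component⊆old {X} {X′} legal (InComp-∩-root {X} {X′} c⇝t t∉X′) c′⇝z)

  play-ends : ∀ r {X c} (w : CopsWin G k r X c) t h → InComp G (inG X) c t → ∃₂ λ ys l → play r w t h ≡ ys ∷ʳ (t , l)
  play-ends zero    ()
  play-ends (suc r) {X} {c} (X′ , legal , cont) t h c⇝t with t ∈? inG X′
  ... | yes t∈X′ = h , label X X′ h , afterRound-caught h legal c⇝t t∈X′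
  ... | no  t∉X′ with resume X cont (root (inG X′) t) | escapes X cont c⇝t t∉X′
  ...   | .(just w′) | w′ , refl = play-ends r w′ t _ (root-InComp t∉X′)

  recorded-later : ∀ r {X c} (w : CopsWin G k (suc r) X c) t h → InComp G (inG X) c t →
                   ∀ {u} → u ∈ₗ V (play (suc r) {X} {c} w t h) → u ∉ₗ V (afterRound X (proj₁ w) c h) →
                   t ∉ inG (proj₁ w) × InComp G (inG (proj₁ w)) (root (inG (proj₁ w)) t) u
  recorded-later r {X} {c} (X′ , legal , cont) t h c⇝t u∈ u∉h′ with t ∈? inG X′
  ... | yes _    = contradiction u∈ u∉h′
  ... | no  t∉X′ with resume X cont (root (inG X′) t) | escapes X cont c⇝t t∉X′
  ...   | .(just w′) | w′ , refl with play-vertices r w′ t _ (root-InComp t∉X′) u∈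
  ...     | inj₁ u∈h′   = contradiction u∈h′ u∉h′
  ...     | inj₂ root⇝u = t∉X′ , root⇝u

  play-prefix : ∀ r {X c} (w : CopsWin G k r X c) t u h → InComp G (inG X) c t → InComp G (inG X) c u →
                u ∈ₗ V (play r w t h) → u ∉ₗ V h → play r w u h ⊑ play r w t h
  play-prefix zero    ()
  play-prefix (suc r) {X} {c} w@(X′ , legal , cont) t u h c⇝t c⇝u u∈ u∉h with u ∈? inG X′
  ... | yes _    = afterRound-⊑-play r w t h
  ... | no  u∉X′ with recorded-later r w t h c⇝t u∈ (∉-afterRound u∉h u∉X′)
  ...   | t∉X′ , root⇝u rewrite root-cong (InComp-trans (InComp-sym root⇝u) (root-InComp t∉X′)) with t ∈? inG X′
  ...     | yes t∈X′ = contradiction t∈X′ t∉X′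
  ...     | no  _ with resume X cont (root (inG X′) t) | escapes X cont c⇝t t∉X′
  ...       | .(just w′) | w′ , refl =
    play-prefix r w′ t u (afterRound X X′ c h) (root-InComp t∉X′) root⇝u u∈ (∉-afterRound u∉h u∉X′)

  play-edge : ∀ r {X c} (w : CopsWin G k r X c) u v h → InComp G (inG X) c u → InComp G (inG X) c v →
              E u v → u ∈ₗ V (play r w v h) ⊎ v ∈ₗ V (play r w u h)
  play-edge zero    ()
  play-edge (suc r) {X} {c} w@(X′ , legal , cont) u v h c⇝u c⇝v e with u ∈? inG X′
  ... | yes u∈X′ = inj₁ (∈-⊑ (∈-afterRound⁺ {X} {c} {X′} legal (u∈X′ , c⇝u))
                             (⊑-map proj₁ (afterRound-⊑-play r w v h)))
  ... | no  u∉X′ with v ∈? inG X′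
  ...   | yes v∈X′ = inj₂ (∈-⊑ (∈-afterRound⁺ {X} {c} {X′} legal (v∈X′ , c⇝v))
                                 (⊑-map proj₁ (⊑-resumed r (resume X cont (root (inG X′) u)) u _)))
  ...   | no  v∉X′ rewrite root-cong (u∉X′ , v∉X′ , edge e)
                   with resume X cont (root (inG X′) v) | escapes X cont c⇝v v∉X′
  ...     | .(just w′) | w′ , refl =
    play-edge r w′ u v _ (InComp-trans (root-InComp v∉X′) (v∉X′ , u∉X′ , edge (E-sym e))) (root-InComp v∉X′) e

  data Proper (v : Fin n) : History → Set where
    []   : Proper v []
    snoc : ∀ {h x l} → Proper v h → (∀ {u l′} → (u , l′) ∈ₗ h → E u v → l ≢ l′) →
           Proper v (h ∷ʳ (x , l))

  Proper-⊑ : ∀ {v h ys x l u l′} → Proper v h → ys ∷ʳ (x , l) ⊑ h → (u , l′) ∈ₗ ys → E u v → l ≢ l′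
  Proper-⊑ {ys = []}    []    (_ , ())
  Proper-⊑ {ys = _ ∷ _} []    (_ , ())
  Proper-⊑ {ys = ys} (snoc {h} proper separated) prefix with ⊑-∷ʳ⁻ prefix
  ... | inj₁ prefix′ = Proper-⊑ proper prefix′
  ... | inj₂ eq with ∷ʳ-injective ys h eq
  ...   | refl , refl = separated

  record Invariant (X : CopPos n k) (c v : Fin n) (h : History) : Set where
    field
      unique   : Unique (V h)
      fresh    : ∀ {z} → z ∈ₗ V h → ¬ InComp G (inG X) c z
      guarded  : ∀ {u} → u ∈ₗ V h → E u v → u ∈ inG X
      proper   : Proper v h

  afterRound-invariant : ∀ {X c X′ v h} → LegalMove G k X c X′ → InComp G (inG X) c v → Invariant X c v h →
                         let h′ = afterRound X X′ c h in
                         Unique (V h′) × (∀ {u} → u ∈ₗ V h′ → E u v → u ∈ inG X′) × Proper v h′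
  afterRound-invariant {X} {c} {X′} {v} {h} legal c⇝v inv with newRecords X X′ c h | newRecords-view X X′ c h
  ... | _ | none _ rewrite ++-identityʳ h =
    unique , (λ u∈ e → adjacent-cop-stays {X} {c} {X′} legal c⇝v (guarded u∈ e) e) , proper
    where open Invariant inv
  ... | _ | one {x} (x∈X′ , c⇝x) = unique′ , guarded′ , snoc proper separated
    where
    open Invariant inv
    S : Subset n
    S = inG (X ∩ᶜ X′)

    V-snoc : ∀ {z} → z ∈ₗ V (h ∷ʳ (x , label X X′ h)) → z ∈ₗ V h ⊎ z ≡ x
    V-snoc z∈ with ∈-++⁻ (V h) (subst (_ ∈ₗ_) (map-++ proj₁ h _) z∈)
    ... | inj₁ z∈h        = inj₁ z∈h
    ... | inj₂ (here z≡x) = inj₂ z≡x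

    unique′ : Unique (V (h ∷ʳ (x , label X X′ h)))
    unique′ = subst Unique (sym (map-++ proj₁ h _))
                (Unique.++⁺ unique ([] ∷ []) λ { (x∈h , here refl) → fresh x∈h c⇝x })

    guarded′ : ∀ {u} → u ∈ₗ V (h ∷ʳ (x , label X X′ h)) → E u v → u ∈ inG X′
    guarded′ u∈ e with V-snoc u∈
    ... | inj₁ u∈h  = adjacent-cop-stays {X} {c} {X′} legal c⇝v (guarded u∈h e) e
    ... | inj₂ refl = x∈X′

    few-labels : length (labelsIn S h) < k
    few-labels = s≤s (≤-trans (length-labelsIn S h unique)
                              (≤-trans (m≤m+n ∣ S ∣ _) (≤-reflexive (proj₁ (proj₂ legal)))))

    separated : ∀ {u l′} → (u , l′) ∈ₗ h → E u v → label X X′ h ≢ l′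
    separated {u} r∈h e refl = unlisted-∉ (labelsIn S h) few-labels (∈-labelsIn r∈h u∈S)
      where
      u∈X : u ∈ inG X
      u∈X = guarded (∈-map⁺ proj₁ r∈h) e
      u∈S : u ∈ S
      u∈S = x∈p∩q⁺ (u∈X , adjacent-cop-stays {X} {c} {X′} legal c⇝v u∈X e)

  next-invariant : ∀ {X c X′ v h} → LegalMove G k X c X′ → InComp G (inG X) c v → v ∉ inG X′ →
                   Invariant X c v h → Invariant X′ (root (inG X′) v) v (afterRound X X′ c h)
  next-invariant {X} {c} {X′} {v} {h} legal c⇝v v∉X′ inv with afterRound-invariant {X} {c} {X′} legal c⇝v inv
  ... | unique′ , guarded′ , proper′ = record
    { unique  = unique′
    ; fresh   = fresh′
    ; guarded = guarded′
    ; proper  = proper′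
    }
    where
    fresh′ : ∀ {z} → z ∈ₗ V (afterRound X X′ c h) → ¬ InComp G (inG X′) (root (inG X′) v) z
    fresh′ z∈ root⇝z with ∈-afterRound⁻ z∈
    ... | inj₁ z∈h        =
      Invariant.fresh inv z∈h (new-component⊆old {X} {X′} legal (InComp-∩-root {X} {X′} c⇝v v∉X′) root⇝z)
    ... | inj₂ (z∈X′ , _) = proj₁ (proj₂ root⇝z) z∈X′

  play-proper : ∀ r {X c} (w : CopsWin G k r X c) v h → InComp G (inG X) c v → Invariant X c v h → Proper v (play r w v h)
  play-proper zero    ()
  play-proper (suc r) {X} {c} (X′ , legal , cont) v h c⇝v inv with v ∈? inG X′
  ... | yes _    = proj₂ (proj₂ (afterRound-invariant {X} {c} {X′} legal c⇝v inv))
  ... | no  v∉X′ with resume X cont (root (inG X′) v) | escapes X cont c⇝v v∉X′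
  ...   | .(just w′) | w′ , refl =
    play-proper r w′ v _ (root-InComp v∉X′) (next-invariant {X} {c} {X′} legal c⇝v v∉X′ inv)

  entry : Fin n → Fin n
  entry t = root S.⊥ t

  entry⇝ : ∀ t → InComp G S.⊥ (entry t) t
  entry⇝ t = root-InComp ∉⊥

  history : Fin n → History
  history t = play q (win (entry t)) t []

  history-ends : ∀ t → ∃₂ λ ys l → history t ≡ ys ∷ʳ (t , l)
  history-ends t = play-ends q (win (entry t)) t [] (entry⇝ t)

  ∈-history : ∀ t → t ∈ₗ V (history t)
  ∈-history t with history-ends t
  ... | ys , _ , eq = subst (λ h → t ∈ₗ V h) (sym eq) (∈-map⁺ proj₁ (∈-++⁺ʳ ys (here refl)))

  history-⊑ : ∀ {u t} → u ∈ₗ V (history t) → history u ⊑ history t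
  history-⊑ {u} {t} u∈ with play-vertices q (win (entry t)) t [] (entry⇝ t) u∈
  ... | inj₂ entry⇝u = subst (λ c → play q (win c) u [] ⊑ history t)
                             (sym (root-cong (InComp-trans (InComp-sym entry⇝u) (entry⇝ t))))
                             (play-prefix q (win (entry t)) t u [] (entry⇝ t) entry⇝u u∈ λ ())

  forest : RootedForest n
  forest = record
    { _≼_       = λ u v → u ∈ₗ V (history v)
    ; ≼-dec     = λ u v → u ∈ₗ? V (history v)
    ; ≼-refl    = ∈-history _
    ; ≼-trans   = λ u∈ v∈ → ∈-⊑ u∈ (⊑-map proj₁ (history-⊑ v∈))
    ; ≼-antisym = antisym
    ; ≼-forest  = λ u∈ w∈ → Sum.map below below (⊑-comparable (history-⊑ u∈) (history-⊑ w∈))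
    }
    where
    below : ∀ {u w} → history u ⊑ history w → u ∈ₗ V (history w)
    below ⊑w = ∈-⊑ (∈-history _) (⊑-map proj₁ ⊑w)

    antisym : ∀ {u v} → u ∈ₗ V (history v) → v ∈ₗ V (history u) → u ≡ v
    antisym {u} {v} u∈ v∈ with history-ends u | history-ends v
    ... | ys , _ , eqᵤ | ys′ , _ , eqᵥ =
      cong proj₁ (proj₂ (∷ʳ-injective ys ys′
        (trans (sym eqᵤ) (trans (⊑-antisym (history-⊑ u∈) (history-⊑ v∈)) eqᵥ))))

  pebble : Fin n → Fin k
  pebble u = maybe′ proj₂ zero (last (history u))

  pebble-ends : ∀ {u ys l} → history u ≡ ys ∷ʳ (u , l) → pebble u ≡ l
  pebble-ends {ys = ys} eq = cong (maybe′ proj₂ zero) (trans (cong last eq) (last-∷ʳ ys _))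

  ∈-history-pebble : ∀ u → (u , pebble u) ∈ₗ history u
  ∈-history-pebble u with history-ends u
  ... | ys , l , eq rewrite pebble-ends eq | eq = ∈-++⁺ʳ ys (here refl)

  open RootedForest forest using (IsChain; Comparable; _≺_; _≼_)

  copsWin⇒cover : PebbleForestCover G k q
  copsWin⇒cover = record
    { F       = forest
    ; p       = pebble
    ; edges   = edges
    ; pebbles = pebbles
    ; depth   = depth
    }
    where
    edges : ∀ {u v} → E u v → Comparable u v
    edges {u} {v} e
      with play-edge q (win (entry v)) u v [] (InComp-trans (entry⇝ v) (∉⊥ , ∉⊥ , edge (E-sym e))) (entry⇝ v) e
    ... | inj₁ u∈ = inj₁ u∈
    ... | inj₂ v∈ = inj₂ (subst (λ c → v ∈ₗ V (play q (win c) u [])) (sym (root-cong (∉⊥ , ∉⊥ , edge e))) v∈)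

    pebbles : ∀ {u v w} → E u v → u ≺ v → u ≺ w → w ≼ v → pebble w ≢ pebble u
    pebbles {u} {v} {w} e _ (u≼w , u≢w) w≼v with history-ends w
    ... | ys , l , eq with ∈-++⁻ ys (subst ((u , pebble u) ∈ₗ_) eq (∈-⊑ (∈-history-pebble u) (history-⊑ u≼w)))
    ...   | inj₂ (here u≡w) = contradiction (cong proj₁ u≡w) u≢w
    ...   | inj₁ u∈ys =
      subst (_≢ pebble u) (sym (pebble-ends eq))
        (Proper-⊑ (play-proper q (win (entry v)) v [] (entry⇝ v) initial) (subst (_⊑ history v) eq (history-⊑ w≼v)) u∈ys e)
      where
      initial : Invariant onK (entry v) v []
      initial = record { unique = [] ; fresh = λ () ; guarded = λ () ; proper = [] }

    depth : ∀ xs → IsChain xs → length xs ≤ q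
    depth []       _                  = z≤n
    depth (x ∷ xs) (unique , chain) with ForestFacts.∃-greatest forest chain
    ... | m , _ , ≼m = begin
      length (x ∷ xs)                ≤⟨ length≤∣p∣ (fromList (V (history m))) unique (∈-fromList ∘ All.lookup ≼m) ⟩
      ∣ fromList (V (history m)) ∣   ≤⟨ ∣fromList∣≤length (V (history m)) ⟩
      length (V (history m))         ≡⟨ length-map proj₁ (history m) ⟩
      length (history m)             ≤⟨ play-length q (win (entry m)) m [] ⟩
      q                              ∎
      where open ≤-Reasoning

lemma16 : ∀ {n} (G : Graph n) (k q : ℕ) → 1 ≤ k → 1 ≤ q →
    (CopsWinsMonCR G k q → InT G k q) × (InT G k q → CopsWinsMonCR G k q)
lemma16 G zero     q ()
lemma16 G (suc k′) q _ 1≤q =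
  StrategyCover.copsWin⇒cover G k′ q , λ cover → CoverStrategy.cover⇒copsWin G (suc k′) q cover 1≤q
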